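{- Let $\mathcal{P}$ be a non-empty finite set of odd primes and let $k\in\mathbb{N}$ be a product of prime powers with primes from $\mathcal{P}$. Let $m$ be a power of $2$. Suppose that for each $p\in\mathcal{P}$ there exists a real number $c(p)$ with $1<c(p)<p$, depending only on $p$, such that $$ s((\mathbb{Z}_p)^n)\leq c(p)^n(p-1)+1 $$ for each $n\geq 1$. Then there exists $c(k)$ with $1<c(k)<k$, depending only on $k$, such that for every $n\geq 1$ $$ s((\mathbb{Z}_{mk})^n)\leq 2^n(m-1)k+c(k)^n(k-1)+1. $$
   Context: A sequence over a finite abelian group $A$ is a finite unordered list of elements of $A$ with repetitions allowed; its length counts multiplicity, a subsequence is a sub-multiset, and a zero-sum sequence is one whose terms sum to $0$. The Erdős–Ginzburg–Ziv constant $s(A)$ is the smallest integer $\ell$ such that every sequence over $A$ of length at least $\ell$ has a zero-sum subsequence of length $\exp(A)$ (the exponent of $A$).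
   Formalization: The constants c(p) in the hypothesis and the constant c(k) in the conclusion are taken in the rationals rather than the reals. -}

module Defs where

open import Data.Nat using (ℕ; zero; suc; _≤_)
open import Data.Nat.Divisibility using (_∣_)
open import Data.Fin using (Fin; toℕ)
open import Data.List using (List; length; map)
open import Data.Nat.ListAction using (sum)
open import Relation.Binary.PropositionalEquality using (_≡_)
open import Data.List.Relation.Binary.Sublist.Propositional using (_⊆_)
open import Data.Product using (Σ; _×_)
open import Data.Integer using (+_)
open import Data.Rational using (ℚ; _/_; _*_; 1ℚ)

-- An element of the group (ℤ_N)^n : a function Fin n → Fin N
-- (coordinates are residues 0,…,N-1; addition is coordinatewise mod N).
Elem : ℕ → ℕ → Set
Elem N n = Fin n → Fin N

-- A sequence over (ℤ_N)^n is a finite list of elements (order irrelevant).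
Seq : ℕ → ℕ → Set
Seq N n = List (Elem N n)

ZeroSum : ∀ {N n} → Seq N n → Set
ZeroSum {N} {n} S = (i : Fin n) → N ∣ sum (map (λ x → toℕ (x i)) S)

EGZProp : ℕ → ℕ → ℕ → Set
EGZProp N n ℓ = (S : Seq N n) → ℓ ≤ length S →
  Σ (Seq N n) (λ T → (T ⊆ S) × (length T ≡ N) × ZeroSum T)

IsEGZConstant : ℕ → ℕ → ℕ → Set
IsEGZConstant N n s = EGZProp N n s × ((ℓ : ℕ) → EGZProp N n ℓ → s ≤ ℓ)

ℕtoℚ : ℕ → ℚ
ℕtoℚ k = (+ k) / 1

_^ℚ_ : ℚ → ℕ → ℚ
c ^ℚ zero = 1ℚ
c ^ℚ suc n = c * (c ^ℚ n)

module Submission where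

-- Everything rests on the multiplicativity inequality
--     s((ℤ_{ab})^n) ≤ a (s((ℤ_b)^n) − 1) + s((ℤ_a)^n),
-- proved in the module Combinatorics for sequences with arbitrary labels in (ℤ_N)^n,
-- handled as multisets (lists up to permutation): cut blocks of a terms summing to 0 mod a,
-- then apply EGZ over ℤ_b to the block sums divided by a.  With the pigeonhole bound
-- s((ℤ_N)^n) ≤ N^n (N − 1) + 1 it gives s((ℤ_{2^e})^n) ≤ 2^n (2^e − 1) + 1.
-- The rational part calls c admissible for k when 1 < c < k and s((ℤ_k)^n) ≤ c^n (k − 1) + 1;
-- admissibility passes to products (c(pq) = p·c(q)), so k obtains an admissible constant by
-- induction over its prime factors, and multiplicativity with the factors k and m = 2^e gives
-- the theorem.  EGZ constants exist only classically (¬¬, by the least-number principle);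
-- as every bound to be shown is a decidable inequality in ℚ, this suffices.

open import Defs

module Combinatorics where
  open import Data.Nat
    using (ℕ; zero; suc; _+_; _*_; _∸_; _^_; _≤_; _<_; _<?_; _≤?_; z≤n; s≤s; NonZero; _/_)
  open import Data.Nat.Properties
  open import Data.Nat.ListAction using (sum)
  open import Data.Nat.ListAction.Properties using (sum-↭; sum-++)
  open import Data.Nat.DivMod using (_mod_; _divMod_; DivMod; m*[n/m]≡n)
  open import Data.Nat.Divisibility using (_∣_; divides; ∣m∣n⇒∣m+n; n∣m*n; *-monoʳ-∣)
  open import Data.Fin using (Fin; toℕ; funToFin; finToFun)
  open import Data.Fin.Properties using (finToFun-funToFin) renaming (_≟_ to _≟ᶠ_)
  open import Data.List using (List; []; _∷_; length; map; _++_; concat; filter; take; allFin)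
  open import Data.List.Properties
    using ( length-map; map-∘; map-++; map-cong-local; length-++; length-take; length-tabulate
          ; ++-assoc; ++-identityʳ; concat-++)
  open import Data.List.Membership.Propositional using (_∈_)
  open import Data.List.Membership.Propositional.Properties using (∈-allFin)
  open import Data.List.Relation.Unary.All as All using (All; []; _∷_)
  open import Data.List.Relation.Unary.All.Properties using (all-filter; ++⁻ˡ)
  open import Data.List.Relation.Unary.Any using (here; there)
  open import Data.List.Relation.Binary.Sublist.Propositional
    using (_⊆_; []; _∷_; _∷ʳ_; ⊆-refl; ⊆-trans)
  open import Data.List.Relation.Binary.Sublist.Propositional.Properties
    using (filter-⊆; take-⊆; All-resp-⊆) renaming (++⁺ʳ to ⊆-++⁺ʳ)
  open import Data.List.Relation.Ternary.Interleaving.Propositional.Properties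
    using (interleave-length; filter⁺)
  open import Relation.Binary.Definitions using (DecidableEquality)
  open import Relation.Nullary using (¬_; Dec; yes; no; contradiction)
  open import Relation.Nullary.Decidable using (decidable-stable)
  open import Relation.Unary.Properties using (∁?)
  open import Data.List.Relation.Binary.Permutation.Propositional as ↭
    using (_↭_; ↭-refl; ↭-reflexive; ↭-trans; ↭-sym)
  open import Data.List.Relation.Binary.Permutation.Propositional.Properties
    using (shift; ↭-length; map⁺; ++⁺; ++⁺ˡ; ++⁺ʳ; All-resp-↭) renaming (++-comm to ↭-++-comm)
  open import Data.Product using (∃; _×_; _,_; proj₁; proj₂)
  open import Relation.Binary.PropositionalEquality
    using (_≡_; refl; sym; trans; cong; cong₂; subst; module ≡-Reasoning)
  open import Data.Nat.Tactic.RingSolver using (solve-∀)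

  _⊑_ : {X : Set} → List X → List X → Set
  T ⊑ S = ∃ λ R → S ↭ T ++ R

  sublist⇒⊑ : {X : Set} {T S : List X} → T ⊆ S → T ⊑ S
  sublist⇒⊑ [] = [] , ↭-refl
  sublist⇒⊑ (y ∷ʳ τ) with R , S↭T++R ← sublist⇒⊑ τ =
    y ∷ R , ↭-trans (↭.prep y S↭T++R) (↭-sym (shift y _ R))
  sublist⇒⊑ (refl ∷ τ) with R , S↭T++R ← sublist⇒⊑ τ = R , ↭.prep _ S↭T++R

  sublist-along-↭ : {X : Set} {S S′ U : List X} → S ↭ S′ → U ⊆ S′ →
    ∃ λ U′ → U′ ⊆ S × U′ ↭ U
  sublist-along-↭ ↭.refl τ = _ , τ , ↭-refl
  sublist-along-↭ (↭.prep x p) (.x ∷ʳ τ) with U′ , σ , q ← sublist-along-↭ p τ =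
    U′ , x ∷ʳ σ , q
  sublist-along-↭ (↭.prep x p) (refl ∷ τ) with U′ , σ , q ← sublist-along-↭ p τ =
    x ∷ U′ , refl ∷ σ , ↭.prep x q
  sublist-along-↭ (↭.swap x y p) (.y ∷ʳ .x ∷ʳ τ) with U′ , σ , q ← sublist-along-↭ p τ =
    U′ , x ∷ʳ y ∷ʳ σ , q
  sublist-along-↭ (↭.swap x y p) (.y ∷ʳ refl ∷ τ) with U′ , σ , q ← sublist-along-↭ p τ =
    x ∷ U′ , refl ∷ y ∷ʳ σ , ↭.prep x q
  sublist-along-↭ (↭.swap x y p) (refl ∷ .x ∷ʳ τ) with U′ , σ , q ← sublist-along-↭ p τ =
    y ∷ U′ , x ∷ʳ refl ∷ σ , ↭.prep y q
  sublist-along-↭ (↭.swap x y p) (refl ∷ refl ∷ τ) with U′ , σ , q ← sublist-along-↭ p τ =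
    x ∷ y ∷ U′ , refl ∷ refl ∷ σ , ↭.swap x y q
  sublist-along-↭ (↭.trans p q) τ =
    let U₁ , τ₁ , r₁ = sublist-along-↭ q τ
        U₂ , τ₂ , r₂ = sublist-along-↭ p τ₁
    in U₂ , τ₂ , ↭-trans r₂ r₁

  ⊑⇒sublist : {X : Set} {T S : List X} → T ⊑ S → ∃ λ U → U ⊆ S × U ↭ T
  ⊑⇒sublist (R , S↭T++R) = sublist-along-↭ S↭T++R (⊆-++⁺ʳ R ⊆-refl)

  ⊑-trans : {X : Set} {T U S : List X} → T ⊑ U → U ⊑ S → T ⊑ S
  ⊑-trans {T = T} (R₁ , U↭T++R₁) (R₂ , S↭U++R₂) =
    R₁ ++ R₂ ,
    ↭-trans S↭U++R₂ (↭-trans (++⁺ʳ R₂ U↭T++R₁) (↭-reflexive (++-assoc T R₁ R₂)))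

  ⊑-length : {X : Set} {T S : List X} → ((R , _) : T ⊑ S) → length S ≡ length T + length R
  ⊑-length {T = T} (R , S↭T++R) = trans (↭-length S↭T++R) (length-++ T)

  concat-↭ : {X : Set} {As Bs : List (List X)} → As ↭ Bs → concat As ↭ concat Bs
  concat-↭ ↭.refl = ↭-refl
  concat-↭ (↭.prep B p) = ++⁺ˡ B (concat-↭ p)
  concat-↭ (↭.swap A B p) = ↭-trans (↭-reflexive (sym (++-assoc A B _)))
    (↭-trans (++⁺ (↭-++-comm A B) (concat-↭ p)) (↭-reflexive (++-assoc B A _)))
  concat-↭ (↭.trans p q) = ↭-trans (concat-↭ p) (concat-↭ q)

  concat-⊑ : {X : Set} {Cs Bs : List (List X)} → Cs ⊑ Bs → concat Cs ⊑ concat Bs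
  concat-⊑ {Cs = Cs} (Ds , Bs↭Cs++Ds) =
    concat Ds , ↭-trans (concat-↭ Bs↭Cs++Ds) (↭-reflexive (sym (concat-++ Cs Ds)))

  sublist-of-map : {X Y : Set} (f : X → Y) (S : List X) {T′ : List Y} → T′ ⊆ map f S →
    ∃ λ T → T ⊆ S × map f T ≡ T′
  sublist-of-map f [] [] = [] , [] , refl
  sublist-of-map f (x ∷ S) (_ ∷ʳ τ) with T , σ , eq ← sublist-of-map f S τ = T , x ∷ʳ σ , eq
  sublist-of-map f (x ∷ S) (refl ∷ τ) with T , σ , eq ← sublist-of-map f S τ =
    x ∷ T , refl ∷ σ , cong (f x ∷_) eq

  sum-const : {X : Set} (f : X → ℕ) (c : ℕ) (U : List X) →
    All (λ x → f x ≡ c) U → sum (map f U) ≡ length U * c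
  sum-const f c [] [] = refl
  sum-const f c (x ∷ U) (fx≡c ∷ rest) = cong₂ _+_ fx≡c (sum-const f c U rest)

  sum-concat : {X : Set} (f : X → ℕ) (Bs : List (List X)) →
    sum (map f (concat Bs)) ≡ sum (map (λ B → sum (map f B)) Bs)
  sum-concat f [] = refl
  sum-concat f (B ∷ Bs) = begin
    sum (map f (B ++ concat Bs))              ≡⟨ cong sum (map-++ f B (concat Bs)) ⟩
    sum (map f B ++ map f (concat Bs))        ≡⟨ sum-++ (map f B) (map f (concat Bs)) ⟩
    sum (map f B) + sum (map f (concat Bs))   ≡⟨ cong (sum (map f B) +_) (sum-concat f Bs) ⟩
    sum (map f B) + sum (map (λ B → sum (map f B)) Bs) ∎
    where open ≡-Reasoning

  sum-scale : {X : Set} (c : ℕ) (f : X → ℕ) (L : List X) →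
    sum (map (λ x → c * f x) L) ≡ c * sum (map f L)
  sum-scale c f [] = sym (*-zeroʳ c)
  sum-scale c f (x ∷ L) = trans (cong (c * f x +_) (sum-scale c f L)) (sym (*-distribˡ-+ c (f x) _))

  length-concat : {X : Set} (a : ℕ) (Bs : List (List X)) → All (λ B → length B ≡ a) Bs →
    length (concat Bs) ≡ length Bs * a
  length-concat a [] [] = refl
  length-concat a (B ∷ Bs) (|B|≡a ∷ rest) =
    trans (length-++ B) (cong₂ _+_ |B|≡a (length-concat a Bs rest))

  ∣-sum-residues : ∀ a .{{_ : NonZero a}} {X : Set} (f : X → ℕ) (L : List X) →
    a ∣ sum (map (λ x → toℕ (f x mod a)) L) → a ∣ sum (map f L)
  ∣-sum-residues a f L a∣residues =
    subst (a ∣_) (sym (sum-by-division L))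
      (∣m∣n⇒∣m+n a∣residues (n∣m*n (sum (map (λ x → f x / a) L))))
    where
    sum-by-division : ∀ L → sum (map f L) ≡
      sum (map (λ x → toℕ (f x mod a)) L) + sum (map (λ x → f x / a) L) * a
    sum-by-division [] = refl
    sum-by-division (x ∷ L) = trans
      (cong₂ _+_ (DivMod.property (f x divMod a)) (sum-by-division L))
      (regroup a (toℕ (f x mod a)) (f x / a) _ _)
      where
      regroup : ∀ a r q r′ q′ → (r + q * a) + (r′ + q′ * a) ≡ (r + r′) + (q + q′) * a
      regroup = solve-∀

  -- The product argument applies EGZ to a sequence of blocks,
  -- labelled by (reduced) block sums, so the property must be stated for labellings.
  -- the i-th coordinate sum of a labelled sequence, and the zero-sum property
  coordSum : {X : Set} {N n : ℕ} → (X → Elem N n) → List X → Fin n → ℕ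
  coordSum π T i = sum (map (λ x → toℕ (π x i)) T)

  ZeroSumBy : {X : Set} {N n : ℕ} → (X → Elem N n) → List X → Set
  ZeroSumBy {N = N} π T = ∀ i → N ∣ coordSum π T i

  LabelledEGZ : ℕ → ℕ → ℕ → Set₁
  LabelledEGZ N n ℓ = ∀ {X : Set} (π : X → Elem N n) (S : List X) → ℓ ≤ length S →
    ∃ λ T → T ⊑ S × length T ≡ N × ZeroSumBy π T

  EGZ⇒labelled : ∀ {N n ℓ} → EGZProp N n ℓ → LabelledEGZ N n ℓ
  EGZ⇒labelled {N} {ℓ = ℓ} egz π S ℓ≤|S|
    with T′ , T′⊆πS , |T′|≡N , zs ←
         egz (map π S) (subst (ℓ ≤_) (sym (length-map π S)) ℓ≤|S|)
    with T , T⊆S , refl ← sublist-of-map π S T′⊆πS =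
    T , sublist⇒⊑ T⊆S , subst (_≡ N) (length-map π T) |T′|≡N ,
    λ i → subst (N ∣_) (cong sum (sym (map-∘ T))) (zs i)

  labelled⇒EGZ : ∀ {N n ℓ} → LabelledEGZ N n ℓ → EGZProp N n ℓ
  labelled⇒EGZ {N} egz S ℓ≤|S| with T , T⊑S , |T|≡N , zs ← egz (λ x → x) S ℓ≤|S|
    with U , U⊆S , U↭T ← ⊑⇒sublist T⊑S =
    U , U⊆S , subst (_≡ N) (sym (↭-length U↭T)) |T|≡N ,
    λ i → subst (N ∣_) (sym (sum-↭ (map⁺ (λ x → toℕ (x i)) U↭T))) (zs i)

  labelled-mono : ∀ {N n ℓ ℓ′} → LabelledEGZ N n ℓ → ℓ ≤ ℓ′ → LabelledEGZ N n ℓ′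
  labelled-mono egz ℓ≤ℓ′ π S ℓ′≤|S| = egz π S (≤-trans ℓ≤ℓ′ ℓ′≤|S|)

  pigeonhole : {X C : Set} → DecidableEquality C → (cs : List C) (colour : X → C)
    (t : ℕ) (L : List X) → All (λ x → colour x ∈ cs) L → length cs * t < length L →
    ∃ λ c → ∃ λ T → T ⊆ L × t < length T × All (λ x → colour x ≡ c) T
  pigeonhole _≟_ [] colour t (x ∷ L) (() ∷ _) _
  pigeonhole {X} _≟_ (c ∷ cs) colour t L coloured big = choose (t <? length same)
    where
    hasColour : (x : X) → Dec (colour x ≡ c)
    hasColour x = colour x ≟ c

    same others : List X
    same = filter hasColour L
    others = filter (∁? hasColour) L

    othersColoured : All (λ x → colour x ∈ cs) others
    othersColoured =
      All.zipWith drop-c (All-resp-⊆ (filter-⊆ _ L) coloured , all-filter (∁? hasColour) L)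
      where
      drop-c : ∀ {x} → colour x ∈ c ∷ cs × ¬ colour x ≡ c → colour x ∈ cs
      drop-c (here eq , ≢c) = contradiction eq ≢c
      drop-c (there ∈cs , _) = ∈cs

    othersBig : ¬ t < length same → length cs * t < length others
    othersBig few = +-cancelˡ-< t _ _ (begin-strict
      t + length cs * t                 <⟨ big ⟩
      length L                          ≡⟨ interleave-length {A = X} (filter⁺ hasColour L) ⟩
      length same + length others       ≤⟨ +-monoˡ-≤ (length others) (≮⇒≥ few) ⟩
      t + length others                 ∎)
      where open ≤-Reasoning

    choose : Dec (t < length same) →
      ∃ λ c → ∃ λ T → T ⊆ L × t < length T × All (λ x → colour x ≡ c) T
    choose (yes many) = c , same , filter-⊆ _ L , many , all-filter hasColour L
    choose (no few) with c′ , T , T⊆ , t<|T| , monochrome ←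
        pigeonhole _≟_ cs colour t others othersColoured (othersBig few) =
      c′ , T , ⊆-trans T⊆ (filter-⊆ _ L) , t<|T| , monochrome

  copies-zero-sum : {X : Set} {N n : ℕ} (π : X → Elem N n) (w : Elem N n) (U : List X) →
    All (λ x → ∀ i → π x i ≡ w i) U → length U ≡ N → ZeroSumBy π U
  copies-zero-sum π w U equal refl i = divides (toℕ (w i)) (begin
    coordSum π U i         ≡⟨ sum-const (λ x → toℕ (π x i)) (toℕ (w i)) U
                                (All.map (λ eq → cong toℕ (eq i)) equal) ⟩
    length U * toℕ (w i)   ≡⟨ *-comm (length U) (toℕ (w i)) ⟩
    toℕ (w i) * length U   ∎)
    where open ≡-Reasoning

  -- The trivial bound s((ℤ_N)^n) ≤ N^n (N − 1) + 1: colouring each element by its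
  -- code in Fin (N^n), some element occurs N times among N^n (N − 1) + 1 terms.
  trivial-bound : ∀ N n → LabelledEGZ N n (suc (N ^ n * (N ∸ 1)))
  trivial-bound N n {X} π S big
    with w , T , T⊆S , N-1<|T| , monochrome ←
         pigeonhole _≟ᶠ_ (allFin (N ^ n)) (λ x → funToFin (π x)) (N ∸ 1) S
           (All.tabulate (λ _ → ∈-allFin _))
           (subst (λ M → M * (N ∸ 1) < length S) (sym (length-tabulate {n = N ^ n} (λ i → i))) big)
    =
    U , sublist⇒⊑ (⊆-trans (take-⊆ N T) T⊆S) , |U|≡N ,
    copies-zero-sum π (finToFun w) U (All.map decode (All-resp-⊆ (take-⊆ N T) monochrome))
      |U|≡N
    where
    decode : ∀ {x} → funToFin (π x) ≡ w → ∀ i → π x i ≡ finToFun w i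
    decode {x} refl i = sym (finToFun-funToFin (π x) i)

    U : List X
    U = take N T

    |U|≡N : length U ≡ N
    |U|≡N = trans (length-take N T) (m≤n⇒m⊓n≡m (enough N N-1<|T|))
      where
      enough : ∀ N {m} → N ∸ 1 < m → N ≤ m
      enough zero _ = z≤n
      enough (suc N) N<m = N<m

  -- From a·K + ℓa terms, greedily cut off K + 1 disjoint blocks of a terms, each
  -- summing to 0 modulo a (every cut needs ℓa terms).  Label each block by its sum
  -- divided by a, read modulo b; among K + 1 labelled blocks, b have labels summing
  -- to 0 modulo b, and the union of these b blocks sums to 0 modulo ab.
  module Product {a b n ℓa K : ℕ} .{{_ : NonZero a}} .{{_ : NonZero b}}
      (egzA : LabelledEGZ a n ℓa) (egzB : LabelledEGZ b n (suc K))
      {X : Set} (π : X → Elem (a * b) n) where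

    Block : List X → Set
    Block B = length B ≡ a × (∀ i → a ∣ coordSum π B i)

    block : (S : List X) → ℓa ≤ length S → ∃ λ B → B ⊑ S × Block B
    block S big with B , B⊑S , |B|≡a , zs ← egzA (λ x i → toℕ (π x i) mod a) S big =
      B , B⊑S , |B|≡a , λ i → ∣-sum-residues a (λ x → toℕ (π x i)) B (zs i)

    remainder-big : ∀ {m S B} → a + m ≤ length S → ((R , _) : B ⊑ S) → Block B → m ≤ length R
    remainder-big {m} {S} {B} big B⊑S@(R , _) (|B|≡a , _) = +-cancelˡ-≤ a m (length R) (begin
      a + m                ≤⟨ big ⟩
      length S             ≡⟨ ⊑-length B⊑S ⟩
      length B + length R  ≡⟨ cong (_+ length R) |B|≡a ⟩
      a + length R         ∎)
      where open ≤-Reasoning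

    more-blocks : ∀ k → a * suc k + ℓa ≡ a + (a * k + ℓa)
    more-blocks k = trans (cong (_+ ℓa) (*-suc a k)) (+-assoc a (a * k) ℓa)

    blocks : ∀ k (S : List X) → a * k + ℓa ≤ length S →
      ∃ λ Bs → length Bs ≡ suc k × All Block Bs × concat Bs ⊑ S
    blocks k S big with block S (≤-trans (m≤n+m ℓa (a * k)) big)
    blocks zero S _ | B , (R , S↭B++R) , isBlock =
      B ∷ [] , refl , isBlock ∷ [] , R , subst (λ C → S ↭ C ++ R) (sym (++-identityʳ B)) S↭B++R
    blocks (suc k) S big | B , B⊑S@(R , S↭B++R) , isBlock
      with Bs , |Bs| , areBlocks , (Rest , R↭Bs++Rest) ←
           blocks k R (remainder-big (subst (_≤ length S) (more-blocks k) big) B⊑S isBlock) =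
      B ∷ Bs , cong suc |Bs| , isBlock ∷ areBlocks , Rest ,
      ↭-trans S↭B++R
        (↭-trans (++⁺ˡ B R↭Bs++Rest) (↭-reflexive (sym (++-assoc B (concat Bs) Rest))))

    quotientLabel : List X → Elem b n
    quotientLabel B i = (coordSum π B i / a) mod b

    union-zero-sum : (Cs : List (List X)) → All Block Cs → ZeroSumBy quotientLabel Cs →
      ZeroSumBy π (concat Cs)
    union-zero-sum Cs areBlocks zs i =
      subst (a * b ∣_) (sym union-sum) (*-monoʳ-∣ a (∣-sum-residues b quotient Cs (zs i)))
      where
      quotient : List X → ℕ
      quotient B = coordSum π B i / a
      blockwise : map (λ B → coordSum π B i) Cs ≡ map (λ B → a * quotient B) Cs
      blockwise = map-cong-local (All.map (λ (_ , a∣) → sym (m*[n/m]≡n (a∣ i))) areBlocks)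
      union-sum : coordSum π (concat Cs) i ≡ a * sum (map quotient Cs)
      union-sum = begin
        coordSum π (concat Cs) i                ≡⟨ sum-concat (λ x → toℕ (π x i)) Cs ⟩
        sum (map (λ B → coordSum π B i) Cs)     ≡⟨ cong sum blockwise ⟩
        sum (map (λ B → a * quotient B) Cs)     ≡⟨ sum-scale a quotient Cs ⟩
        a * sum (map quotient Cs)               ∎
        where open ≡-Reasoning

    zero-sum-part : (S : List X) → a * K + ℓa ≤ length S →
      ∃ λ T → T ⊑ S × length T ≡ a * b × ZeroSumBy π T
    zero-sum-part S big
      with Bs , |Bs| , areBlocks , Bs⊑S ← blocks K S big
      with Cs , Cs⊑Bs , |Cs|≡b , zs ← egzB quotientLabel Bs (≤-reflexive (sym |Bs|)) =
      concat Cs , ⊑-trans (concat-⊑ Cs⊑Bs) Bs⊑S , |union| , union-zero-sum Cs chosen zs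
      where
      chosen : All Block Cs
      chosen = ++⁻ˡ Cs (All-resp-↭ (proj₂ Cs⊑Bs) areBlocks)
      |union| : length (concat Cs) ≡ a * b
      |union| = trans (length-concat a Cs (All.map proj₁ chosen))
                      (trans (cong (_* a) |Cs|≡b) (*-comm b a))

  egz-product : ∀ {a b n ℓa K} .{{_ : NonZero a}} .{{_ : NonZero b}} →
    LabelledEGZ a n ℓa → LabelledEGZ b n (suc K) → LabelledEGZ (a * b) n (a * K + ℓa)
  egz-product egzA egzB π = Product.zero-sum-part egzA egzB π

  -- s((ℤ_{2^e})^n) ≤ 2^n (2^e − 1) + 1: induction on e, combining the trivial bound
  -- for ℤ_2 with multiplicativity (ℤ_{2^{e+1}} = ℤ_{2·2^e}).
  two-power-bound : ∀ e n → LabelledEGZ (2 ^ e) n (suc (2 ^ n * (2 ^ e ∸ 1)))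
  two-power-bound zero n =
    labelled-mono (trivial-bound 1 n)
      (≤-reflexive (cong suc (trans (*-zeroʳ (1 ^ n)) (sym (*-zeroʳ (2 ^ n))))))
  two-power-bound (suc e) n =
    labelled-mono (egz-product {{_}} {{m^n≢0 2 e}} (trivial-bound 2 n) (two-power-bound e n))
      (≤-reflexive (doubling (2 ^ n) (2 ^ e) {{m^n≢0 2 e}}))
    where
    doubling : ∀ x y .{{_ : NonZero y}} → 2 * (x * (y ∸ 1)) + suc (x * 1) ≡ suc (x * (2 * y ∸ 1))
    doubling x (suc d) = ring x d
      where
      ring : ∀ x d → 2 * (x * d) + suc (x * 1) ≡ suc (x * (d + suc (d + 0)))
      ring = solve-∀

  -- EGZProp is not decidable, so the EGZ constant
  -- s((ℤ_N)^n) exists only in this sense.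
  ¬¬-least : (P : ℕ → Set) {ℓ₀ : ℕ} → P ℓ₀ → ¬ ¬ (∃ λ s → P s × (∀ ℓ → P ℓ → s ≤ ℓ))
  ¬¬-least P {ℓ₀} Pℓ₀ noLeast = none-below (suc ℓ₀) ℓ₀ ≤-refl Pℓ₀
    where
    none-below : ∀ b ℓ → ℓ < b → ¬ P ℓ
    none-below (suc b) ℓ (s≤s ℓ≤b) Pℓ = noLeast (ℓ , Pℓ , least)
      where
      least : ∀ ℓ′ → P ℓ′ → ℓ ≤ ℓ′
      least ℓ′ Pℓ′ with ℓ ≤? ℓ′
      ... | yes ℓ≤ℓ′ = ℓ≤ℓ′
      ... | no ℓ≰ℓ′ = contradiction Pℓ′ (none-below b ℓ′ (<-≤-trans (≰⇒> ℓ≰ℓ′) ℓ≤b))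

  egz-constant-exists : ∀ N n → ¬ ¬ ∃ (IsEGZConstant N n)
  egz-constant-exists N n = ¬¬-least (EGZProp N n) (labelled⇒EGZ (trivial-bound N n))

  egz-positive : ∀ {N n ℓ} .{{_ : NonZero N}} → EGZProp N n ℓ → 0 < ℓ
  egz-positive {suc N} {ℓ = zero} egz with egz [] z≤n
  ... | [] , [] , () , _
  egz-positive {ℓ = suc ℓ} egz = s≤s z≤n

  constant-product : ∀ {a b n sa sb s} .{{_ : NonZero a}} .{{_ : NonZero b}} →
    IsEGZConstant a n sa → IsEGZConstant b n sb → IsEGZConstant (a * b) n s → s ≤ a * (sb ∸ 1) + sa
  constant-product {sb = zero} _ (egzB , _) _ = contradiction (egz-positive egzB) (λ ())
  constant-product {sb = suc K} (egzA , _) (egzB , _) (_ , least) =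
    least _ (labelled⇒EGZ (egz-product (EGZ⇒labelled egzA) (EGZ⇒labelled egzB)))

  with-factor-constants : ∀ {a b n s} .{{_ : NonZero a}} .{{_ : NonZero b}} {G : Set} → Dec G →
    IsEGZConstant (a * b) n s →
    (∀ {sa sb} → IsEGZConstant a n sa → IsEGZConstant b n sb → s ≤ a * (sb ∸ 1) + sa → G) → G
  with-factor-constants {a} {b} {n} G? sConst prove = decidable-stable G? λ ¬G →
    egz-constant-exists a n λ (sa , saConst) →
    egz-constant-exists b n λ (sb , sbConst) →
    ¬G (prove saConst sbConst (constant-product saConst sbConst sConst))

open import Data.Nat using (ℕ; _∸_; _^_; _≥_) renaming (_*_ to _*ℕ_)
open import Data.Nat.ListAction using (product)
open import Data.Nat.Divisibility using (_∣_)
open import Data.Nat.Primality using (Prime)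
open import Data.List using (List; []; _∷_)
open import Data.List.Membership.Propositional using (_∈_)
open import Data.List.Relation.Unary.All as All using (All; []; _∷_)
open import Data.Product using (Σ; _×_; _,_; proj₁)
open import Relation.Binary.PropositionalEquality using (_≡_; _≢_; refl; cong; subst; subst₂)
  renaming (sym to ≡-sym; trans to ≡-trans)
open import Relation.Nullary using (¬_; contradiction)
open import Data.Rational
  using (ℚ; _<_; _≤_; _+_; _*_; _/_; 1ℚ; 0ℚ; mkℚ; -_; _≤?_; *≤*; nonNegative; positive)
open import Data.Rational.Properties
open import Data.Rational.Solver using (module +-*-Solver)
import Data.Nat as ℕ
import Data.Nat.Properties as ℕ
open import Data.Nat.Tactic.RingSolver using (solve-∀)
open import Data.Nat.Coprimality using (1-coprimeTo) renaming (sym to coprime-sym)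
open import Data.Integer as ℤ using (+_; +≤+)
import Data.Integer.Properties as ℤ
open Combinatorics using (with-factor-constants; egz-positive; two-power-bound; labelled⇒EGZ)

ℕtoℚ-normal : ∀ x → ℕtoℚ x ≡ mkℚ (+ x) 0 (coprime-sym (1-coprimeTo x))
ℕtoℚ-normal x = normalize-coprime (coprime-sym (1-coprimeTo x))

ℕtoℚ-+ : ∀ x y → ℕtoℚ (x ℕ.+ y) ≡ ℕtoℚ x + ℕtoℚ y
ℕtoℚ-+ x y rewrite ℕtoℚ-normal x | ℕtoℚ-normal y | ℕ.*-identityʳ x | ℕ.*-identityʳ y
  | ℤ.◃-inverse (+ x) | ℤ.◃-inverse (+ y) = refl

ℕtoℚ-* : ∀ x y → ℕtoℚ (x *ℕ y) ≡ ℕtoℚ x * ℕtoℚ y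
ℕtoℚ-* x y rewrite ℕtoℚ-normal x | ℕtoℚ-normal y = cong (_/ 1) (ℤ.pos-* x y)

ℕtoℚ-mono-≤ : ∀ {x y} → x ℕ.≤ y → ℕtoℚ x ≤ ℕtoℚ y
ℕtoℚ-mono-≤ {x} {y} x≤y rewrite ℕtoℚ-normal x | ℕtoℚ-normal y =
  *≤* (subst₂ ℤ._≤_ (≡-sym (ℤ.*-identityʳ (+ x))) (≡-sym (ℤ.*-identityʳ (+ y))) (+≤+ x≤y))

ℕtoℚ-cancel-≤ : ∀ {x y} → ℕtoℚ x ≤ ℕtoℚ y → x ℕ.≤ y
ℕtoℚ-cancel-≤ {x} {y} x≤y rewrite ℕtoℚ-normal x | ℕtoℚ-normal y
  with +≤+ x≤y ← subst₂ ℤ._≤_ (ℤ.*-identityʳ (+ x)) (ℤ.*-identityʳ (+ y)) (drop-*≤* x≤y)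
  = x≤y

ℕtoℚ-nonNeg : ∀ x → 0ℚ ≤ ℕtoℚ x
ℕtoℚ-nonNeg x = ℕtoℚ-mono-≤ {0} {x} ℕ.z≤n

ℕtoℚ*-mono : ∀ x {u v} → u ≤ v → ℕtoℚ x * u ≤ ℕtoℚ x * v
ℕtoℚ*-mono x = *-monoˡ-≤-nonNeg (ℕtoℚ x) {{nonNegative (ℕtoℚ-nonNeg x)}}

*ℕtoℚ-mono : ∀ x {u v} → u ≤ v → u * ℕtoℚ x ≤ v * ℕtoℚ x
*ℕtoℚ-mono x = *-monoʳ-≤-nonNeg (ℕtoℚ x) {{nonNegative (ℕtoℚ-nonNeg x)}}

+-cancelʳ-≤ : ∀ c {a b} → a + c ≤ b + c → a ≤ b
+-cancelʳ-≤ c {a} {b} a+c≤b+c = subst₂ _≤_ (cancel a) (cancel b) (+-monoˡ-≤ (- c) a+c≤b+c)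
  where
  cancel : ∀ x → x + c + - c ≡ x
  cancel x = ≡-trans (+-assoc x c (- c)) (≡-trans (cong (λ y → x + y) (+-inverseʳ c)) (+-identityʳ x))

ℕtoℚ-pred : ∀ {s X} → 0 ℕ.< s → ℕtoℚ s ≤ X + 1ℚ → ℕtoℚ (s ∸ 1) ≤ X
ℕtoℚ-pred {ℕ.suc s} {X} _ s+1≤X+1 =
  +-cancelʳ-≤ 1ℚ (subst (_≤ X + 1ℚ) (≡-trans (cong ℕtoℚ (ℕ.+-comm 1 s)) (ℕtoℚ-+ s 1)) s+1≤X+1)

*-mono-≤-nonNeg : ∀ {p q r s} → 0ℚ ≤ q → 0ℚ ≤ r → p ≤ q → r ≤ s → p * r ≤ q * s
*-mono-≤-nonNeg {q = q} {r = r} 0≤q 0≤r p≤q r≤s =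
  ≤-trans (*-monoʳ-≤-nonNeg r {{nonNegative 0≤r}} p≤q)
          (*-monoˡ-≤-nonNeg q {{nonNegative 0≤q}} r≤s)

^ℚ-nonNeg : ∀ {x} n → 0ℚ ≤ x → 0ℚ ≤ x ^ℚ n
^ℚ-nonNeg ℕ.zero _ = *≤* (+≤+ ℕ.z≤n)
^ℚ-nonNeg {x} (ℕ.suc n) 0≤x =
  ≤-trans (≤-reflexive (≡-sym (*-zeroˡ (x ^ℚ n))))
          (*-mono-≤-nonNeg 0≤x (^ℚ-nonNeg n 0≤x) 0≤x ≤-refl)

^ℚ-mono : ∀ {x y} n → 0ℚ ≤ x → x ≤ y → x ^ℚ n ≤ y ^ℚ n
^ℚ-mono ℕ.zero _ _ = ≤-refl
^ℚ-mono (ℕ.suc n) 0≤x x≤y =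
  *-mono-≤-nonNeg (≤-trans 0≤x x≤y) (^ℚ-nonNeg n 0≤x) x≤y (^ℚ-mono n 0≤x x≤y)

ℕtoℚ-affine : ∀ {s a x y X Y} → s ℕ.≤ a *ℕ x ℕ.+ y → ℕtoℚ x ≤ X → ℕtoℚ y ≤ Y →
  ℕtoℚ s ≤ ℕtoℚ a * X + Y
ℕtoℚ-affine {s} {a} {x} {y} {X} {Y} s≤ax+y x≤X y≤Y = begin
  ℕtoℚ s                       ≤⟨ ℕtoℚ-mono-≤ s≤ax+y ⟩
  ℕtoℚ (a *ℕ x ℕ.+ y)          ≡⟨ ℕtoℚ-+ (a *ℕ x) y ⟩
  ℕtoℚ (a *ℕ x) + ℕtoℚ y       ≡⟨ cong (_+ ℕtoℚ y) (ℕtoℚ-* a x) ⟩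
  ℕtoℚ a * ℕtoℚ x + ℕtoℚ y     ≤⟨ +-mono-≤ (ℕtoℚ*-mono a x≤X) y≤Y ⟩
  ℕtoℚ a * X + Y               ∎
  where open ≤-Reasoning

EGZBound : ℕ → ℚ → Set
EGZBound k c = (n : ℕ) → n ≥ 1 → (s : ℕ) → IsEGZConstant k n s →
  ℕtoℚ s ≤ (c ^ℚ n) * ℕtoℚ (k ∸ 1) + 1ℚ

Admissible : ℕ → ℚ → Set
Admissible k c = (1ℚ < c) × (c < ℕtoℚ k) × EGZBound k c

admissible-nonZero : ∀ {k c} → Admissible k c → ℕ.NonZero k
admissible-nonZero {k} (1<c , c<k , _) = ℕ.>-nonZero (ℕtoℚ-cancel-≤ {1} {k} (<⇒≤ (<-trans 1<c c<k)))

pred-product : ∀ p q .{{_ : ℕ.NonZero p}} .{{_ : ℕ.NonZero q}} →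
  p *ℕ (q ∸ 1) ℕ.+ (p ∸ 1) ≡ p *ℕ q ∸ 1
pred-product (ℕ.suc p) (ℕ.suc q) = ring p q
  where
  ring : ∀ p q → ℕ.suc p *ℕ q ℕ.+ p ≡ q ℕ.+ p *ℕ ℕ.suc q
  ring = solve-∀

-- Using s(pq) ≤ p (s(q) − 1) + s(p) and c_p, c_q ≤ c:
--   s(pq) ≤ p c_q^n (q − 1) + c_p^n (p − 1) + 1 ≤ c^n (pq − 1) + 1.
admissible-product : ∀ {p q cp cq} → Admissible p cp → Admissible q cq →
  Admissible (p *ℕ q) (ℕtoℚ p * cq)
admissible-product {p} {q} {cp} {cq} admP@(1<cp , cp<p , boundP) admQ@(1<cq , cq<q , boundQ) =
  <-≤-trans 1<cq cq≤c , c<pq , boundPQ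
  where
  instance
    _ = admissible-nonZero admP
    _ = admissible-nonZero admQ
  P = ℕtoℚ p
  c = P * cq
  0≤cp = <⇒≤ (<-trans (positive⁻¹ 1ℚ) 1<cp)
  0≤cq = <⇒≤ (<-trans (positive⁻¹ 1ℚ) 1<cq)
  1≤P : 1ℚ ≤ P
  1≤P = <⇒≤ (<-trans 1<cp cp<p)

  cq≤c : cq ≤ c
  cq≤c = subst (_≤ c) (*-identityˡ cq) (*-monoʳ-≤-nonNeg cq {{nonNegative 0≤cq}} 1≤P)

  cp≤c : cp ≤ c
  cp≤c = ≤-trans (<⇒≤ cp<p) (subst (_≤ c) (*-identityʳ P) (ℕtoℚ*-mono p (<⇒≤ 1<cq)))

  c<pq : c < ℕtoℚ (p *ℕ q)
  c<pq = subst (c <_) (≡-sym (ℕtoℚ-* p q))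
    (*-monoʳ-<-pos P {{positive (<-≤-trans (positive⁻¹ 1ℚ) 1≤P)}} cq<q)

  from-factors : ∀ n → n ≥ 1 → ∀ {s sp sq} → IsEGZConstant p n sp → IsEGZConstant q n sq →
    s ℕ.≤ p *ℕ (sq ∸ 1) ℕ.+ sp → ℕtoℚ s ≤ c ^ℚ n * ℕtoℚ (p *ℕ q ∸ 1) + 1ℚ
  from-factors n n≥1 {s} {sp} {sq} spConst sqConst s≤ = begin
    ℕtoℚ s
      ≤⟨ ℕtoℚ-affine {a = p} s≤ sq-1≤ (boundP n n≥1 sp spConst) ⟩
    P * (cq ^ℚ n * Q₁) + (cp ^ℚ n * P₁ + 1ℚ)
      ≤⟨ +-mono-≤ (ℕtoℚ*-mono p cq-part) (+-monoˡ-≤ 1ℚ cp-part) ⟩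
    P * (c ^ℚ n * Q₁) + (c ^ℚ n * P₁ + 1ℚ)   ≡⟨ regroup P (c ^ℚ n) Q₁ P₁ ⟩
    c ^ℚ n * (P * Q₁ + P₁) + 1ℚ              ≡⟨ cong (λ t → c ^ℚ n * t + 1ℚ) pq-1 ⟩
    c ^ℚ n * ℕtoℚ (p *ℕ q ∸ 1) + 1ℚ          ∎
    where
    open ≤-Reasoning
    Q₁ = ℕtoℚ (q ∸ 1)
    P₁ = ℕtoℚ (p ∸ 1)
    sq-1≤ : ℕtoℚ (sq ∸ 1) ≤ cq ^ℚ n * Q₁
    sq-1≤ = ℕtoℚ-pred (egz-positive (proj₁ sqConst)) (boundQ n n≥1 sq sqConst)
    cq-part : cq ^ℚ n * Q₁ ≤ c ^ℚ n * Q₁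
    cq-part = *ℕtoℚ-mono (q ∸ 1) (^ℚ-mono n 0≤cq cq≤c)
    cp-part : cp ^ℚ n * P₁ ≤ c ^ℚ n * P₁
    cp-part = *ℕtoℚ-mono (p ∸ 1) (^ℚ-mono n 0≤cp cp≤c)
    regroup : ∀ P C Q₁ P₁ → P * (C * Q₁) + (C * P₁ + 1ℚ) ≡ C * (P * Q₁ + P₁) + 1ℚ
    regroup = solve 4 (λ P C Q₁ P₁ →
      P :* (C :* Q₁) :+ (C :* P₁ :+ con 1ℚ) := C :* (P :* Q₁ :+ P₁) :+ con 1ℚ) refl
      where open +-*-Solver
    pq-1 : P * Q₁ + P₁ ≡ ℕtoℚ (p *ℕ q ∸ 1)
    pq-1 = ≡-trans (cong (_+ P₁) (≡-sym (ℕtoℚ-* p (q ∸ 1))))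
             (≡-trans (≡-sym (ℕtoℚ-+ (p *ℕ (q ∸ 1)) (p ∸ 1))) (cong ℕtoℚ (pred-product p q)))

  boundPQ : EGZBound (p *ℕ q) c
  boundPQ n n≥1 s sConst = with-factor-constants {p} {q} (_ ≤? _) sConst (from-factors n n≥1)

admissible-for-products : (ps : List ℕ) → ps ≢ [] → All (λ p → Σ ℚ (Admissible p)) ps →
  Σ ℚ (Admissible (product ps))
admissible-for-products [] ps≢[] _ = contradiction refl ps≢[]
admissible-for-products (p ∷ []) _ ((c , adm) ∷ []) =
  c , subst (λ k → Admissible k c) (≡-sym (ℕ.*-identityʳ p)) adm
admissible-for-products (p ∷ ps@(_ ∷ _)) _ ((_ , admP) ∷ rest) =
  let c , adm = admissible-for-products ps (λ ()) rest in ℕtoℚ p * c , admissible-product admP adm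

-- The bound of the theorem for (ℤ_{2^e k})^n: multiplicativity with the factors k and
-- 2^e gives s ≤ k (s((ℤ_{2^e})^n) − 1) + s((ℤ_k)^n) ≤ 2^n (2^e − 1) k + c^n (k − 1) + 1.
two-power-times-bound : ∀ {k c} → Admissible k c → ∀ e n → n ≥ 1 → ∀ s →
  IsEGZConstant (2 ^ e *ℕ k) n s →
  ℕtoℚ s ≤ ℕtoℚ ((2 ^ n) *ℕ (2 ^ e ∸ 1) *ℕ k) + (c ^ℚ n) * ℕtoℚ (k ∸ 1) + 1ℚ
two-power-times-bound {k} {c} adm@(_ , _ , boundK) e n n≥1 s sConst =
  with-factor-constants {k} {2 ^ e} {{admissible-nonZero adm}} {{ℕ.m^n≢0 2 e}} (_ ≤? _)
    (subst (λ N → IsEGZConstant N n s) (ℕ.*-comm (2 ^ e) k) sConst) from-factors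
  where
  X = 2 ^ n *ℕ (2 ^ e ∸ 1)
  K₁ = ℕtoℚ (k ∸ 1)

  two-power-constant : ∀ {sm} → IsEGZConstant (2 ^ e) n sm → sm ∸ 1 ℕ.≤ X
  two-power-constant (_ , least) = ℕ.∸-monoˡ-≤ 1 (least _ (labelled⇒EGZ (two-power-bound e n)))

  from-factors : ∀ {sk sm} → IsEGZConstant k n sk → IsEGZConstant (2 ^ e) n sm →
    s ℕ.≤ k *ℕ (sm ∸ 1) ℕ.+ sk → ℕtoℚ s ≤ ℕtoℚ (X *ℕ k) + c ^ℚ n * K₁ + 1ℚ
  from-factors {sk} skConst smConst s≤ = begin
    ℕtoℚ s                               ≤⟨ ℕtoℚ-affine {a = k} s≤ (ℕtoℚ-mono-≤ (two-power-constant smConst))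
                                                            (boundK n n≥1 sk skConst) ⟩
    ℕtoℚ k * ℕtoℚ X + (c ^ℚ n * K₁ + 1ℚ) ≡⟨ cong (_+ (c ^ℚ n * K₁ + 1ℚ)) kX≡Xk ⟩
    ℕtoℚ (X *ℕ k) + (c ^ℚ n * K₁ + 1ℚ)   ≡⟨ ≡-sym (+-assoc (ℕtoℚ (X *ℕ k)) _ 1ℚ) ⟩
    ℕtoℚ (X *ℕ k) + c ^ℚ n * K₁ + 1ℚ     ∎
    where
    open ≤-Reasoning
    kX≡Xk : ℕtoℚ k * ℕtoℚ X ≡ ℕtoℚ (X *ℕ k)
    kX≡Xk = ≡-trans (≡-sym (ℕtoℚ-* k X)) (cong ℕtoℚ (ℕ.*-comm k X))

corollary1p12 : (P : List ℕ) → P ≢ [] → All (λ p → Prime p × ¬ (2 ∣ p)) P →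
    (k : ℕ) → Σ (List ℕ) (λ ps → (ps ≢ []) × All (λ q → q ∈ P) ps × (product ps ≡ k)) →
    ((p : ℕ) → p ∈ P → Σ ℚ (λ c → (1ℚ < c) × (c < ℕtoℚ p) ×
        ((n : ℕ) → n ≥ 1 → (s : ℕ) → IsEGZConstant p n s →
          ℕtoℚ s ≤ (c ^ℚ n) * ℕtoℚ (p ∸ 1) + 1ℚ))) →
    Σ ℚ (λ c → (1ℚ < c) × (c < ℕtoℚ k) ×
      ((m : ℕ) → Σ ℕ (λ e → m ≡ 2 ^ e) →
       (n : ℕ) → n ≥ 1 → (s : ℕ) → IsEGZConstant (m *ℕ k) n s →
        ℕtoℚ s ≤ ℕtoℚ ((2 ^ n) *ℕ (m ∸ 1) *ℕ k) + (c ^ℚ n) * ℕtoℚ (k ∸ 1) + 1ℚ))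
corollary1p12 P _ _ k (ps , ps≢[] , ps⊆P , refl) hyp =
  let c , 1<c , c<k , boundK = admissible-for-products ps ps≢[] (All.map (λ {p} → hyp p) ps⊆P)
  in c , 1<c , c<k , λ { m (e , refl) → two-power-times-bound (1<c , c<k , boundK) e }
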